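{- Let $R$ and $S$ be two non-collapsing iTRSs over disjoint signatures, both with term metric $\infty$, and both strongly converging. Then their disjoint union $R+S$ (again with term metric $\infty$) is strongly converging.
   Context: A signature is a set of function symbols of finite arity. The term metric $\infty$ assigns to every $n$-ary symbol the map $(x_1,\dots,x_n)\mapsto \tfrac12\max(x_1,\dots,x_n)$; the induced distance $d_\infty$ on finite terms is $d_\infty(t,t)=0$, $d_\infty(t,u)=1$ for different root symbols, $d_\infty(F(\vec t),F(\vec u))=\tfrac12\max_i d_\infty(t_i,u_i)$, and $\mathrm{Ter}_\infty$ is its metric completion (the finite and infinite terms). An iTRS consists of a signature, a term metric, and a set $R\subseteq\mathrm{Ter}_\infty\times\mathrm{Ter}_\infty$ of rules $l\to r$ with $l$ not a variable and variables of $r$ occurring in $l$; a rewrite step contracts an instance $\theta(l)$ of a left-hand side at some position $p$ (the redex position) of a term, replacing it by $\theta(r)$. It is non-collapsing if no right-hand side is a variable. A reduction sequence is a continuous map $f:\alpha\to\mathrm{Ter}_\infty$ ($\alpha$ an ordinal with the order topology) with $f(\beta)\to f(\beta+1)$ for $\beta+1<\alpha$; it is open if $\alpha$ is a limit ordinal. The iTRS is strongly converging if for every open reduction sequence of length $\alpha$ (with each step equipped with its redex position) and every position $p$, there is $\beta<\alpha$ such that no step $f(\gamma)\to f(\gamma+1)$ with $\beta\le\gamma$ contracts a redex at position $p$. The disjoint union of two iTRSs with disjoint signatures has the union of the signatures, the union of the rule sets, and term metric $\infty$. -}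

module Defs where

open import Level using (0ℓ)
open import Data.Nat using (ℕ) renaming (_<_ to _<ℕ_; _≤_ to _≤ℕ_)
open import Data.List using (List; []; _∷_; _++_; [_]; length)
open import Data.Maybe using (Maybe; just; nothing)
open import Data.Sum using (_⊎_; inj₁; inj₂)
open import Data.Product using (Σ; ∃; _×_; _,_)
open import Data.Empty using (⊥)
open import Relation.Nullary using (¬_; yes; no)
open import Relation.Binary using (Rel; IsStrictTotalOrder)
open import Relation.Binary.PropositionalEquality using (_≡_)
open import Induction.WellFounded using (WellFounded)
import Data.Nat as ℕ

record Signature : Set₁ where
  field
    Sym : Set
    ar  : Sym → ℕ

open Signature public

-- positions: root-first sequences of argument indices; child i of p is p ++ [ i ]
Pos : Set
Pos = List ℕ

Var : Set
Var = ℕ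

Label : Signature → Set
Label Σ′ = Sym Σ′ ⊎ Var

-- a labelling of positions (partial: nothing = not a position of the term)
PreTerm : Signature → Set
PreTerm Σ′ = Pos → Maybe (Label Σ′)

Defined : ∀ {A : Set} → Maybe A → Set
Defined m = ∃ λ a → m ≡ just a

-- well-formed (finite or infinite) terms, i.e. elements of Ter_∞
record IsTerm (Σ′ : Signature) (t : PreTerm Σ′) : Set where
  field
    root     : Defined (t [])
    children : ∀ (p : Pos) (i : ℕ) →
               (Defined (t (p ++ [ i ])) →
                  ∃ λ F → t p ≡ just (inj₁ F) × i <ℕ ar Σ′ F)
             × ((∃ λ F → t p ≡ just (inj₁ F) × i <ℕ ar Σ′ F) →
                  Defined (t (p ++ [ i ])))

record Term (Σ′ : Signature) : Set where
  constructor mkTerm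
  field
    lab    : PreTerm Σ′
    isTerm : IsTerm Σ′ lab

open Term public

-- The term metric ∞ :  d_∞(t,u) < 2^(-n)  iff  t and u agree on all
-- positions of length ≤ n  (d_∞(t,u) = 2^(-k), k the least depth of a
-- difference).

Close : ∀ {Σ′} → ℕ → Term Σ′ → Term Σ′ → Set
Close n t u = ∀ (q : Pos) → length q ≤ℕ n → lab t q ≡ lab u q

subst : ∀ {Σ′} → PreTerm Σ′ → (Var → Term Σ′) → PreTerm Σ′
subst l θ q with l []
... | just (inj₂ x) = lab (θ x) q
... | _ with q
...   | []     = l []
...   | i ∷ q′ = subst (λ p → l (i ∷ p)) θ q′

strip : Pos → Pos → Maybe Pos
strip []      q       = just q
strip (i ∷ p) []      = nothing
strip (i ∷ p) (j ∷ q) with i ℕ.≟ j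
... | yes _ = strip p q
... | no  _ = nothing

replace : ∀ Σ′ → PreTerm Σ′ → Pos → PreTerm Σ′ → PreTerm Σ′
replace Σ′ t p s q with strip p q
... | just q′ = s q′
... | nothing = t q

-- iTRSs with term metric ∞ (the metric is fixed, so not a field)

IsVarLabel : ∀ Σ′ → Maybe (Label Σ′) → Set
IsVarLabel Σ′ m = ∃ λ x → m ≡ just (inj₂ x)

Occurs : ∀ {Σ′} → Var → Term Σ′ → Set
Occurs x t = ∃ λ q → lab t q ≡ just (inj₂ x)

record iTRS : Set₁ where
  field
    sig  : Signature
    Rule : Term sig → Term sig → Set

open iTRS public

IsITRS : iTRS → Set
IsITRS T = ∀ (l r : Term (sig T)) → Rule T l r →
  ¬ IsVarLabel (sig T) (lab l []) × (∀ x → Occurs x r → Occurs x l)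

NonCollapsing : iTRS → Set
NonCollapsing T = ∀ (l r : Term (sig T)) → Rule T l r → ¬ IsVarLabel (sig T) (lab r [])

Step : (T : iTRS) → Pos → Term (sig T) → Term (sig T) → Set
Step T p t u =
  ∃ λ (l : Term (sig T)) → ∃ λ (r : Term (sig T)) → Rule T l r × ∃ λ (θ : Var → Term (sig T)) →
    (∀ q → lab t (p ++ q) ≡ subst (lab l) θ q)
  × (∀ q → lab u q ≡ replace (sig T) (lab t) p (subst (lab r) θ) q)

record Ordinal : Set₁ where
  field
    Carrier : Set
    _≺_     : Rel Carrier 0ℓ
    isSTO   : IsStrictTotalOrder _≡_ _≺_
    wf      : WellFounded _≺_

  _≼_ : Rel Carrier 0ℓ
  β ≼ γ = β ≺ γ ⊎ β ≡ γ

  IsSucc : Carrier → Carrier → Set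
  IsSucc β γ = β ≺ γ × (∀ δ → β ≺ δ → ¬ δ ≺ γ)

  IsLimitPoint : Carrier → Set
  IsLimitPoint l = (∃ λ β → β ≺ l) × (∀ β → β ≺ l → ∃ λ δ → β ≺ δ × δ ≺ l)

open Ordinal public

IsLimitOrdinal : Ordinal → Set
IsLimitOrdinal α = Carrier α × (∀ β → ∃ λ γ → _≺_ α β γ)

-- continuity of f : α → Ter_∞ (order topology vs. metric d_∞);
-- only limit points are non-isolated
Continuous : ∀ {Σ′} (α : Ordinal) → (Carrier α → Term Σ′) → Set
Continuous α f =
  ∀ l → IsLimitPoint α l → ∀ (n : ℕ) →
    ∃ λ β → _≺_ α β l × (∀ γ → _≺_ α β γ → _≺_ α γ l → Close n (f γ) (f l))

-- an open reduction sequence of length α (α a limit ordinal), each step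
-- equipped with its redex position
record OpenRedSeq (T : iTRS) (α : Ordinal) : Set where
  field
    f    : Carrier α → Term (sig T)
    pos  : Carrier α → Pos
    cont : Continuous α f
    step : ∀ β γ → IsSucc α β γ → Step T (pos β) (f β) (f γ)

open OpenRedSeq public

StronglyConverging : iTRS → Set₁
StronglyConverging T =
  ∀ (α : Ordinal) → IsLimitOrdinal α → (s : OpenRedSeq T α) → ∀ (p : Pos) →
    ∃ λ β → ∀ γ → _≼_ α β γ → ¬ (pos s γ ≡ p)

_⊕_ : Signature → Signature → Signature
Σ₁ ⊕ Σ₂ = record { Sym = Sym Σ₁ ⊎ Sym Σ₂ ; ar = λ { (inj₁ F) → ar Σ₁ F ; (inj₂ G) → ar Σ₂ G } }

module _ {Σ₁ Σ₂ : Signature} where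
  mapLabel₁ : Maybe (Label Σ₁) → Maybe (Label (Σ₁ ⊕ Σ₂))
  mapLabel₁ (just (inj₁ F)) = just (inj₁ (inj₁ F))
  mapLabel₁ (just (inj₂ x)) = just (inj₂ x)
  mapLabel₁ nothing         = nothing

  mapLabel₂ : Maybe (Label Σ₂) → Maybe (Label (Σ₁ ⊕ Σ₂))
  mapLabel₂ (just (inj₁ G)) = just (inj₁ (inj₂ G))
  mapLabel₂ (just (inj₂ x)) = just (inj₂ x)
  mapLabel₂ nothing         = nothing

UnionRule : (R S : iTRS) → Term (sig R ⊕ sig S) → Term (sig R ⊕ sig S) → Set
UnionRule R S l r =
    (∃ λ l₁ → ∃ λ r₁ → Rule R l₁ r₁ ×
       (∀ q → lab l q ≡ mapLabel₁ {sig R} {sig S} (lab l₁ q)) ×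
       (∀ q → lab r q ≡ mapLabel₁ {sig R} {sig S} (lab r₁ q)))
  ⊎ (∃ λ l₂ → ∃ λ r₂ → Rule S l₂ r₂ ×
       (∀ q → lab l q ≡ mapLabel₂ {sig R} {sig S} (lab l₂ q)) ×
       (∀ q → lab r q ≡ mapLabel₂ {sig R} {sig S} (lab r₂ q)))

_+ᵀ_ : iTRS → iTRS → iTRS
R +ᵀ S = record { sig = sig R ⊕ sig S ; Rule = UnionRule R S }

-- Fix an open (R+S)-reduction sequence and a position p. By induction on p we may assume that
-- from some point β₀ on no step contracts a redex strictly above p. Suppose steps at p were
-- cofinal; then cofinally many of them contract, say, R-redexes. Consider the cap at p: the
-- maximal context of R-symbols at p, with every alien subterm replaced by a variable. As neither
-- system is collapsing, after β₀ a step changes the cap only if it contracts an R-redex inside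
-- it, and then it performs the corresponding R-step on the cap. Restricting the index ordinal to
-- these steps yields an open R-reduction sequence of caps, continuous because the cap is constant
-- between consecutive retained steps, with cofinally many root steps: this contradicts strong
-- convergence of R.

module Submission where

open import Defs
open import Level using (Level; 0ℓ)
open import Axiom.ExcludedMiddle using (ExcludedMiddle)
open import Data.Nat as ℕ using (ℕ; suc; z≤n; s≤s) renaming (_≤_ to _≤ℕ_; _<_ to _<ℕ_)
open import Data.Nat.Properties using (≤-refl; +-monoʳ-≤)
open import Data.List using ([]; _∷_; _++_; [_]; _∷ʳ_; length)
open import Data.List.Properties using (++-assoc; ++-identityʳ; length-++; ∷-injective; ++-cancelˡ; ++-conicalˡ; ++-conicalʳ)
open import Data.List.Reverse using (Reverse; []; _∶_∶ʳ_; reverseView)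
open import Data.Maybe using (Maybe; just; nothing; maybe′)
open import Data.Sum using (_⊎_; inj₁; inj₂)
open import Data.Product using (Σ; ∃; _×_; _,_; proj₁; proj₂)
open import Function using (_∘_; case_of_)
open import Relation.Nullary using (¬_; Dec; yes; no; contradiction)
open import Relation.Nullary.Decidable using (decidable-stable; True; toWitness; fromWitness)
open import Relation.Binary using (IsStrictTotalOrder; Trichotomous; tri<; tri≈; tri>)
import Relation.Binary.Construct.On as On
open import Data.Bool.Properties using (T-irrelevant)
open import Induction.WellFounded using (Acc; acc)
open import Relation.Binary.PropositionalEquality hiding ([_]; subst)
open ≡-Reasoning
open import Relation.Binary.PropositionalEquality using () renaming (subst to transport)

_↓_ : ∀ {A : Set} → (Pos → A) → Pos → Pos → A
(X ↓ p) q = X (p ++ q)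

↓-root : ∀ {A : Set} (X : Pos → A) k → X k ≡ (X ↓ k) []
↓-root X k = cong X (sym (++-identityʳ k))

AgreeUpTo : ∀ {A : Set} → ℕ → (Pos → A) → (Pos → A) → Set
AgreeUpTo n X Y = ∀ q → length q ≤ℕ n → X q ≡ Y q

Prefix : Pos → Pos → Set
Prefix q p = ∃ λ k → q ++ k ≡ p

ProperPrefix : Pos → Pos → Set
ProperPrefix q p = ∃ λ j → ∃ λ k → q ++ j ∷ k ≡ p

strip-sound : ∀ p q {k} → strip p q ≡ just k → q ≡ p ++ k
strip-sound []      q       refl = refl
strip-sound (i ∷ p) []      ()
strip-sound (i ∷ p) (j ∷ q) e with i ℕ.≟ j
strip-sound (i ∷ p) (j ∷ q) e  | yes refl = cong (i ∷_) (strip-sound p q e)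
strip-sound (i ∷ p) (j ∷ q) () | no _

strip-++-++ : ∀ p k q → strip (p ++ k) (p ++ q) ≡ strip k q
strip-++-++ []      k q = refl
strip-++-++ (i ∷ p) k q with i ℕ.≟ i
... | yes _  = strip-++-++ p k q
... | no i≢i = contradiction refl i≢i

strip-++ : ∀ p q → strip p (p ++ q) ≡ just q
strip-++ p q = trans (cong (λ p′ → strip p′ (p ++ q)) (sym (++-identityʳ p))) (strip-++-++ p [] q)

strip-∷-≢ : ∀ {i j} k q → j ≢ i → strip (j ∷ k) (i ∷ q) ≡ nothing
strip-∷-≢ {i} {j} k q j≢i with j ℕ.≟ i
... | yes j≡i = contradiction j≡i j≢i
... | no _    = refl

++-split : ∀ P w p q → P ++ w ≡ p ++ q → (∃ λ k → P ≡ p ++ k) ⊎ ProperPrefix P p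
++-split P       w []      q e = inj₁ (P , refl)
++-split []      w (j ∷ p) q e = inj₂ (j , p , refl)
++-split (i ∷ P) w (j ∷ p) q e with ∷-injective e
... | refl , e′ with ++-split P w p q e′
...   | inj₁ (k , P≡p++k)        = inj₁ (k , cong (i ∷_) P≡p++k)
...   | inj₂ (j′ , k , P++j′k≡p) = inj₂ (j′ , k , cong (i ∷_) P++j′k≡p)

strip-++-incomparable : ∀ P p → strip p P ≡ nothing → ¬ ProperPrefix P p →
  ∀ q → strip P (p ++ q) ≡ nothing
strip-++-incomparable P p p⋢P P⋤p q with strip P (p ++ q) in e
... | nothing = refl
... | just w with ++-split P w p q (sym (strip-sound P (p ++ q) e))
...   | inj₂ P⊏p = contradiction P⊏p P⋤p
...   | inj₁ (k , refl) = case trans (sym (strip-++ p k)) p⋢P of λ ()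

prefix-∷ʳ : ∀ q k p i → q ++ k ≡ p ∷ʳ i → q ≡ p ∷ʳ i ⊎ Prefix q p
prefix-∷ʳ []      k p       i e = inj₂ (p , refl)
prefix-∷ʳ (x ∷ q) k []      i e with ∷-injective e
... | refl , q++k≡[] = inj₁ (cong (x ∷_) (++-conicalˡ q k q++k≡[]))
prefix-∷ʳ (x ∷ q) k (y ∷ p) i e with ∷-injective e
... | refl , e′ with prefix-∷ʳ q k p i e′
...   | inj₁ q≡p∷ʳi    = inj₁ (cong (x ∷_) q≡p∷ʳi)
...   | inj₂ (k′ , e″) = inj₂ (k′ , cong (x ∷_) e″)

properPrefix-∷ʳ : ∀ q p i → ProperPrefix q (p ∷ʳ i) → Prefix q p
properPrefix-∷ʳ q p i (j , k , e) with prefix-∷ʳ q (j ∷ k) p i e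
... | inj₂ q⊑p = q⊑p
... | inj₁ refl with ++-cancelˡ (p ∷ʳ i) (j ∷ k) [] (trans e (sym (++-identityʳ (p ∷ʳ i))))
...   | ()

replace-inside : ∀ Σ′ (X S : PreTerm Σ′) P Q {w} → strip P Q ≡ just w → replace Σ′ X P S Q ≡ S w
replace-inside Σ′ X S P Q e rewrite e = refl

replace-outside : ∀ Σ′ (X S : PreTerm Σ′) P Q → strip P Q ≡ nothing → replace Σ′ X P S Q ≡ X Q
replace-outside Σ′ X S P Q e rewrite e = refl

replace-resp-strip : ∀ Σ′ (X Y S : PreTerm Σ′) P Q P′ Q′ → strip P Q ≡ strip P′ Q′ → X Q ≡ Y Q′ →
  replace Σ′ X P S Q ≡ replace Σ′ Y P′ S Q′
replace-resp-strip Σ′ X Y S P Q P′ Q′ e XQ≡YQ′ with strip P′ Q′ in e′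
... | just w  = replace-inside Σ′ X S P Q e
... | nothing = trans (replace-outside Σ′ X S P Q e) XQ≡YQ′

replace-congˡ : ∀ Σ′ {X Y : PreTerm Σ′} S P → X ≗ Y → replace Σ′ X P S ≗ replace Σ′ Y P S
replace-congˡ Σ′ {X} {Y} S P X≗Y Q = replace-resp-strip Σ′ X Y S P Q P Q refl (X≗Y Q)

replace-++ : ∀ Σ′ (X S : PreTerm Σ′) p k q →
  replace Σ′ X (p ++ k) S (p ++ q) ≡ replace Σ′ (X ↓ p) k S q
replace-++ Σ′ X S p k q = replace-resp-strip Σ′ X (X ↓ p) S (p ++ k) (p ++ q) k q (strip-++-++ p k q) refl

replace-∷-≢ : ∀ Σ′ (X S : PreTerm Σ′) j k i q → j ≢ i → replace Σ′ X (j ∷ k) S (i ∷ q) ≡ X (i ∷ q)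
replace-∷-≢ Σ′ X S j k i q j≢i = replace-outside Σ′ X S (j ∷ k) (i ∷ q) (strip-∷-≢ k q j≢i)

subst-var : ∀ {Σ′} (L : PreTerm Σ′) (θ : Var → Term Σ′) {x} → L [] ≡ just (inj₂ x) → subst L θ ≗ lab (θ x)
subst-var L θ e q rewrite e = refl

subst-root : ∀ {Σ′} (L : PreTerm Σ′) (θ : Var → Term Σ′) → ¬ IsVarLabel Σ′ (L []) → subst L θ [] ≡ L []
subst-root L θ ¬var with L [] in e
... | just (inj₂ x) = contradiction (x , refl) ¬var
... | just (inj₁ F) = e
... | nothing       = e

subst-child : ∀ {Σ′} (L : PreTerm Σ′) (θ : Var → Term Σ′) → ¬ IsVarLabel Σ′ (L []) →
  ∀ i q → subst L θ (i ∷ q) ≡ subst (L ↓ [ i ]) θ q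
subst-child L θ ¬var i q with L []
... | just (inj₂ x) = contradiction (x , refl) ¬var
... | just (inj₁ F) = refl
... | nothing       = refl

replace-root-defined : ∀ Σ′ (X S : PreTerm Σ′) k → Defined (X []) → Defined (S []) → Defined (replace Σ′ X k S [])
replace-root-defined Σ′ X S []      _     S-def = S-def
replace-root-defined Σ′ X S (j ∷ k) X-def _     = X-def

HasChild : ∀ Σ′ → Maybe (Label Σ′) → ℕ → Set
HasChild Σ′ m i = ∃ λ F → m ≡ just (inj₁ F) × i <ℕ ar Σ′ F

ChildCondition : ∀ Σ′ → Maybe (Label Σ′) → Maybe (Label Σ′) → ℕ → Set
ChildCondition Σ′ m d i = (Defined d → HasChild Σ′ m i) × (HasChild Σ′ m i → Defined d)

Children : ∀ Σ′ → PreTerm Σ′ → Set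
Children Σ′ X = ∀ q i → ChildCondition Σ′ (X q) (X (q ++ [ i ])) i

children-↓ : ∀ {Σ′} (t : Term Σ′) p → Children Σ′ (lab t ↓ p)
children-↓ t p q i rewrite sym (++-assoc p q [ i ]) = IsTerm.children (isTerm t) (p ++ q) i

children-cong : ∀ {Σ′} {X Y : PreTerm Σ′} → X ≗ Y → Children Σ′ X → Children Σ′ Y
children-cong X≗Y ch q i rewrite sym (X≗Y q) | sym (X≗Y (q ++ [ i ])) = ch q i

root-hasChild : ∀ {Σ′} (X : PreTerm Σ′) → Children Σ′ X → ∀ j k → Defined (X (j ∷ k)) → HasChild Σ′ (X []) j
root-hasChild X ch j []      d = proj₁ (ch [] j) d
root-hasChild X ch j (i ∷ k) d with root-hasChild (X ↓ [ j ]) (ch ∘ (j ∷_)) i k d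
... | F , e , _ = proj₁ (ch [] j) (inj₁ F , e)

root-undefined : ∀ {Σ′} (X : PreTerm Σ′) → Children Σ′ X → X [] ≡ nothing → ∀ i → X [ i ] ≡ nothing
root-undefined X ch e i with X [ i ] in e′
... | nothing = refl
... | just a with proj₁ (ch [] i) (a , e′)
...   | F , e″ , _ = case trans (sym e) e″ of λ ()

IsSymLabel : ∀ Σ′ → Maybe (Label Σ′) → Set
IsSymLabel Σ′ m = ∃ λ F → m ≡ just (inj₁ F)

isVar? : ∀ {Σ′} (m : Maybe (Label Σ′)) → Dec (IsVarLabel Σ′ m)
isVar? (just (inj₂ x)) = yes (x , refl)
isVar? (just (inj₁ F)) = no λ { (_ , ()) }
isVar? nothing         = no λ { (_ , ()) }

isSym⇒defined : ∀ {Σ′} {m : Maybe (Label Σ′)} → IsSymLabel Σ′ m → Defined m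
isSym⇒defined (F , e) = inj₁ F , e

isSym⇒¬isVar : ∀ {Σ′} {m : Maybe (Label Σ′)} → IsSymLabel Σ′ m → ¬ IsVarLabel Σ′ m
isSym⇒¬isVar (F , refl) (x , ())

root-isSym : ∀ {Σ′} (t : Term Σ′) → ¬ IsVarLabel Σ′ (lab t []) → IsSymLabel Σ′ (lab t [])
root-isSym t ¬var with IsTerm.root (isTerm t)
... | inj₁ F , e = F , e
... | inj₂ x , e = contradiction (x , e) ¬var

step-resp-target : ∀ {T′ : iTRS} {P t u u′} → Step T′ P t u → lab u ≗ lab u′ → Step T′ P t u′
step-resp-target (l , r , rule , θ , redex , contract) u≗u′ =
  l , r , rule , θ , redex , λ q → trans (sym (u≗u′ q)) (contract q)

redex-isSym : ∀ {T′ : iTRS} → (∀ {l r} → Rule T′ l r → IsSymLabel (sig T′) (lab l [])) →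
  ∀ {P t u} → Step T′ P t u → IsSymLabel (sig T′) (lab t (P ++ []))
redex-isSym {T′} lhs-isSym (l , r , rule , θ , redex , _) = transport (IsSymLabel (sig T′))
  (sym (trans (redex []) (subst-root (lab l) θ (isSym⇒¬isVar {sig T′} (lhs-isSym rule))))) (lhs-isSym rule)

-- Ordinals, classically

module ClassicalOrdinal (em : ExcludedMiddle 0ℓ) (α : Ordinal) where

  open Ordinal α using () renaming (Carrier to C; _≺_ to _<_; _≼_ to _≤_)
  open IsStrictTotalOrder (isSTO α) using (compare; irrefl) renaming (trans to <-trans)

  <-irrefl : ∀ {x} → ¬ x < x
  <-irrefl = irrefl refl

  ≤-trans : ∀ {x y z} → x ≤ y → y ≤ z → x ≤ z
  ≤-trans (inj₁ x<y) (inj₁ y<z) = inj₁ (<-trans x<y y<z)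
  ≤-trans (inj₁ x<y) (inj₂ refl) = inj₁ x<y
  ≤-trans (inj₂ refl) y≤z        = y≤z

  <-≤-trans : ∀ {x y z} → x < y → y ≤ z → x < z
  <-≤-trans x<y (inj₁ y<z) = <-trans x<y y<z
  <-≤-trans x<y (inj₂ refl) = x<y

  ≤-<-trans : ∀ {x y z} → x ≤ y → y < z → x < z
  ≤-<-trans (inj₁ x<y) y<z = <-trans x<y y<z
  ≤-<-trans (inj₂ refl) y<z = y<z

  ≮⇒≥ : ∀ {x y} → ¬ y < x → x ≤ y
  ≮⇒≥ {x} {y} y≮x with compare x y
  ... | tri< x<y _ _ = inj₁ x<y
  ... | tri≈ _ x≡y _ = inj₂ x≡y
  ... | tri> _ _ y<x = contradiction y<x y≮x

  ≤⇒≯ : ∀ {x y} → x ≤ y → ¬ y < x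
  ≤⇒≯ x≤y y<x = <-irrefl (≤-<-trans x≤y y<x)

  join : ∀ x y → ∃ λ m → x ≤ m × y ≤ m × (∀ {b} → x < b → y < b → m < b)
  join x y with compare x y
  ... | tri< x<y _ _    = y , inj₁ x<y , inj₂ refl , λ _ y<b → y<b
  ... | tri≈ _ refl _   = x , inj₂ refl , inj₂ refl , λ x<b _ → x<b
  ... | tri> _ _ y<x    = x , inj₂ refl , inj₁ y<x , λ x<b _ → x<b

  minimal : (P : C → Set) → ∃ P → ∃ λ γ → P γ × (∀ δ → P δ → ¬ δ < γ)
  minimal P (x , Px) = decidable-stable em λ ∄minimal → ¬P ∄minimal x (wf α x) Px
    where
    ¬P : ¬ (∃ λ γ → P γ × (∀ δ → P δ → ¬ δ < γ)) → ∀ γ → Acc _<_ γ → ¬ P γ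
    ¬P ∄minimal γ (acc rs) Pγ = ∄minimal (γ , Pγ , λ δ Pδ δ<γ → ¬P ∄minimal δ (rs δ<γ) Pδ)

  successor : ∀ {β b} → β < b → ∃ (IsSucc α β)
  successor {β} β<b with minimal (β <_) (_ , β<b)
  ... | γ , β<γ , least = γ , β<γ , λ δ β<δ δ<γ → least δ β<δ δ<γ

  succ-least : ∀ {β γ δ} → IsSucc α β γ → β < δ → γ ≤ δ
  succ-least (_ , nothing-between) β<δ = ≮⇒≥ (nothing-between _ β<δ)

  limitPoint : ∀ {a b} → a < b → ¬ (∃ λ e → IsSucc α e b) → IsLimitPoint α b
  limitPoint {a} {b} a<b no-pred = (a , a<b) , λ β β<b → between β β<b (successor β<b)
    where
    between : ∀ β → β < b → ∃ (IsSucc α β) → ∃ λ δ → β < δ × δ < b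
    between β β<b (β⁺ , β⁺-succ) with succ-least β⁺-succ β<b
    ... | inj₁ β⁺<b = β⁺ , proj₁ β⁺-succ , β⁺<b
    ... | inj₂ refl = contradiction (β , β⁺-succ) no-pred

  StepsConstant : ∀ {Σ′} → (C → Term Σ′) → C → C → Set
  StepsConstant h a b = ∀ ε ε⁺ → a ≤ ε → ε < b → IsSucc α ε ε⁺ → lab (h ε) ≗ lab (h ε⁺)

  stepsConstant-< : ∀ {Σ′} (h : C → Term Σ′) {a b b′} → b′ < b → StepsConstant h a b → StepsConstant h a b′
  stepsConstant-< h b′<b steps ε ε⁺ a≤ε ε<b′ = steps ε ε⁺ a≤ε (<-trans ε<b′ b′<b)

  -- Transfinite induction on b: successor steps by hypothesis, limits by continuity.
  constant-on-interval : ∀ {Σ′} (h : C → Term Σ′) → Continuous α h →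
    ∀ {a b} → a ≤ b → StepsConstant h a b → lab (h a) ≗ lab (h b)
  constant-on-interval h h-cont {a} {b} = go b (wf α b)
    where
    go : ∀ b → Acc _<_ b → a ≤ b → StepsConstant h a b → lab (h a) ≗ lab (h b)
    go b _ (inj₂ refl) _ q = refl
    go b (acc rs) (inj₁ a<b) steps q with em {∃ λ ε → IsSucc α ε b}
    ... | yes (ε , ε-succ) =
      trans (go ε (rs (proj₁ ε-succ)) a≤ε (stepsConstant-< h (proj₁ ε-succ) steps) q)
            (steps ε b a≤ε (proj₁ ε-succ) ε-succ q)
      where
      a≤ε : a ≤ ε
      a≤ε = ≮⇒≥ (λ ε<a → proj₂ ε-succ a ε<a a<b)
    ... | no no-pred with h-cont b (limitPoint a<b no-pred) (length q)
    ...   | β , β<b , close with join a β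
    ...     | m , a≤m , β≤m , join< with successor (join< a<b β<b)
    ...       | σ , σ-succ =
      trans (go σ (rs σ<b) (≤-trans a≤m (inj₁ (proj₁ σ-succ))) (stepsConstant-< h σ<b steps) q)
            (close σ (≤-<-trans β≤m (proj₁ σ-succ)) σ<b q ≤-refl)
      where
      σ<b : σ < b
      σ<b with succ-least σ-succ (join< a<b β<b)
      ... | inj₁ σ<b = σ<b
      ... | inj₂ refl = contradiction (m , σ-succ) no-pred

  module _ (P : C → Set) (l : C) where

    UpperBound : C → Set
    UpperBound u = u ≤ l × (∀ z → P z → z < l → z ≤ u)

    supremum : (∃ λ b → P b × b < l) → (∀ z → P z → z < l → ∃ λ w → P w × z < w × w < l) →
      ∃ λ δ → δ ≤ l × IsLimitPoint α δ × (∀ z → P z → z < l → z < δ)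
                    × (∀ β → β < δ → ∃ λ z → P z × z < l × β < z)
    supremum (b , Pb , b<l) unbounded with minimal UpperBound (l , inj₂ refl , λ z _ z<l → inj₁ z<l)
    ... | δ , (δ≤l , bounds) , least = δ , δ≤l , δ-limit , below , cofinal
      where
      below : ∀ z → P z → z < l → z < δ
      below z Pz z<l with bounds z Pz z<l
      ... | inj₁ z<δ = z<δ
      ... | inj₂ refl with unbounded z Pz z<l
      ...   | w , Pw , z<w , w<l = contradiction z<w (≤⇒≯ (bounds w Pw w<l))

      cofinal : ∀ β → β < δ → ∃ λ z → P z × z < l × β < z
      cofinal β β<δ = decidable-stable em λ ∄z →
        least β (inj₁ (<-≤-trans β<δ δ≤l) , λ z Pz z<l → ≮⇒≥ λ β<z → ∄z (z , Pz , z<l , β<z)) β<δ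

      δ-limit : IsLimitPoint α δ
      δ-limit = (b , below b Pb b<l) , λ β β<δ →
        let (z , Pz , z<l , β<z) = cofinal β β<δ in z , β<z , below z Pz z<l

  module Restriction (P : C → Set) where

    -- Membership is made proof-irrelevant so that points of the restriction are equal iff their
    -- underlying points are.
    Member : C → Set
    Member γ = True (em {P γ})

    C′ : Set
    C′ = Σ C Member

    _<′_ : C′ → C′ → Set
    x <′ y = proj₁ x < proj₁ y

    member : (x : C′) → P (proj₁ x)
    member (γ , m) = toWitness {a? = em {P γ}} m

    ⟨_⟩ : ∀ {γ} → P γ → C′
    ⟨_⟩ {γ} Pγ = γ , fromWitness {a? = em {P γ}} Pγ

    C′-≡ : ∀ {x y : C′} → proj₁ x ≡ proj₁ y → x ≡ y
    C′-≡ {γ , m} {.γ , m′} refl = cong (γ ,_) (T-irrelevant m m′)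

    restrict : Ordinal
    restrict = record
      { Carrier = C′
      ; _≺_     = _<′_
      ; isSTO   = record
        { isStrictPartialOrder = record
          { isEquivalence = isEquivalence
          ; irrefl        = λ { refl → <-irrefl }
          ; trans         = <-trans
          ; <-resp-≈      = (λ { refl x<y → x<y }) , (λ { refl x<y → x<y }) }
        ; compare = compare′ }
      ; wf      = On.wellFounded proj₁ (wf α) }
      where
      compare′ : Trichotomous _≡_ _<′_
      compare′ x y with compare (proj₁ x) (proj₁ y)
      ... | tri< a ¬b ¬c = tri< a (¬b ∘ cong proj₁) ¬c
      ... | tri≈ ¬a b ¬c = tri≈ ¬a (C′-≡ b) ¬c
      ... | tri> ¬a ¬b c = tri> ¬a (¬b ∘ cong proj₁) c

    ≤⇒≤′ : ∀ {x y : C′} → proj₁ x ≤ proj₁ y → Ordinal._≼_ restrict x y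
    ≤⇒≤′ (inj₁ x<y) = inj₁ x<y
    ≤⇒≤′ (inj₂ x≡y) = inj₂ (C′-≡ x≡y)

    restrict-limit : IsLimitOrdinal α → (∀ β → ∃ λ γ → β ≤ γ × P γ) → IsLimitOrdinal restrict
    restrict-limit (β , unbounded) cofinal = ⟨ proj₂ (proj₂ (cofinal β)) ⟩ , above
      where
      above : ∀ x → ∃ λ y → x <′ y
      above x with unbounded (proj₁ x)
      ... | β′ , x<β′ with cofinal β′
      ...   | γ , β′≤γ , Pγ = ⟨ Pγ ⟩ , <-≤-trans x<β′ β′≤γ

    restrict-gap : ∀ {x y} → IsSucc restrict x y → ∀ ε → proj₁ x < ε → ε < proj₁ y → ¬ P ε
    restrict-gap (_ , nothing-between) ε x<ε ε<y Pε = nothing-between ⟨ Pε ⟩ x<ε ε<y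

    ConstantOnGaps : ∀ {Σ′} → (C → Term Σ′) → Set
    ConstantOnGaps h = ∀ z a b → P z → z ≤ a → a ≤ b → (∀ ε → a ≤ ε → ε < b → ¬ P ε) →
      lab (h a) ≗ lab (h b)

    restrict-continuous : ∀ {Σ′} (h : C → Term Σ′) → Continuous α h → ConstantOnGaps h →
      Continuous restrict (h ∘ proj₁)
    restrict-continuous h h-cont gaps l ((b , b<l) , dense) n
      with supremum P (proj₁ l) (proj₁ b , member b , b<l) unbounded
      where
      unbounded : ∀ z → P z → z < proj₁ l → ∃ λ w → P w × z < w × w < proj₁ l
      unbounded z Pz z<l = let (w , z<w , w<l) = dense ⟨ Pz ⟩ z<l in proj₁ w , member w , z<w , w<l
    ... | δ , δ≤l , δ-limit , below , cofinal with h-cont δ δ-limit n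
    ...   | β , β<δ , close with cofinal β β<δ
    ...     | z , Pz , z<l , β<z = ⟨ Pz ⟩ , z<l , λ γ z<γ γ<l q q≤n →
      trans (close (proj₁ γ) (<-trans β<z z<γ) (below (proj₁ γ) (member γ) γ<l) q q≤n)
            (gaps (proj₁ b) δ (proj₁ l) (member b) (inj₁ (below (proj₁ b) (member b) b<l)) δ≤l
                  (λ ε δ≤ε ε<l Pε → ≤⇒≯ δ≤ε (below ε Pε ε<l)) q)

-- Caps

record Embedding (Σ₀ U : Signature) : Set where
  field
    ι          : Sym Σ₀ → Sym U
    layer      : Sym U → Maybe (Sym Σ₀)
    layer-ι    : ∀ F → layer (ι F) ≡ just F
    layer-just : ∀ {G F} → layer G ≡ just F → G ≡ ι F
    ar-ι       : ∀ F → ar U (ι F) ≡ ar Σ₀ F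

module Layer {Σ₀ U : Signature} (E : Embedding Σ₀ U) where
  open Embedding E

  embed : Maybe (Label Σ₀) → Maybe (Label U)
  embed (just (inj₁ F)) = just (inj₁ (ι F))
  embed (just (inj₂ x)) = just (inj₂ x)
  embed nothing         = nothing

  Alien : Maybe (Label U) → Set
  Alien m = ∃ λ G → m ≡ just (inj₁ G) × layer G ≡ nothing

  Native : Maybe (Label U) → Set
  Native m = ∃ λ G → ∃ λ F → m ≡ just (inj₁ G) × layer G ≡ just F

  alien? : ∀ m → Dec (Alien m)
  alien? (just (inj₁ G)) with layer G in e
  ... | nothing = yes (G , refl , e)
  ... | just F  = no λ { (.G , refl , e′) → case trans (sym e) e′ of λ () }
  alien? (just (inj₂ x)) = no λ { (_ , () , _) }
  alien? nothing         = no λ { (_ , () , _) }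

  native⇒¬alien : ∀ {m} → Native m → ¬ Alien m
  native⇒¬alien (G , F , refl , e) (.G , refl , e′) = case trans (sym e) e′ of λ ()

  native⇒isSym : ∀ {m} → Native m → IsSymLabel U m
  native⇒isSym (G , _ , e , _) = G , e

  alien⇒isSym : ∀ {m} → Alien m → IsSymLabel U m
  alien⇒isSym (G , e , _) = G , e

  embed-¬alien : ∀ m → ¬ Alien (embed m)
  embed-¬alien (just (inj₁ F)) (_ , refl , e) = case trans (sym (layer-ι F)) e of λ ()
  embed-¬alien (just (inj₂ x)) (_ , () , _)
  embed-¬alien nothing         (_ , () , _)

  embed-native : ∀ {m} → IsSymLabel Σ₀ m → Native (embed m)
  embed-native (F , refl) = ι F , F , refl , layer-ι F

  embed-¬isVar : ∀ {m} → ¬ IsVarLabel Σ₀ m → ¬ IsVarLabel U (embed m)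
  embed-¬isVar {just (inj₂ x)} ¬var _ = ¬var (x , refl)
  embed-¬isVar {just (inj₁ F)} ¬var (_ , ())
  embed-¬isVar {nothing}       ¬var (_ , ())

  -- The cap replaces every maximal alien subterm by the variable 0.
  capLabel : Maybe (Label U) → Maybe (Label Σ₀)
  capLabel (just (inj₁ G)) = maybe′ (just ∘ inj₁) (just (inj₂ 0)) (layer G)
  capLabel (just (inj₂ x)) = just (inj₂ x)
  capLabel nothing         = nothing

  beneath : Maybe (Label U) → Maybe (Label Σ₀) → Maybe (Label Σ₀)
  beneath (just (inj₁ G)) r = maybe′ (λ _ → r) nothing (layer G)
  beneath (just (inj₂ x)) r = r
  beneath nothing         r = r

  cap : PreTerm U → PreTerm Σ₀
  cap X []      = capLabel (X [])
  cap X (i ∷ q) = beneath (X []) (cap (X ↓ [ i ]) q)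

  -- Positions outside a term have an empty labelling; its cap is taken to be the variable 0.
  capRoot : Maybe (Label U) → Maybe (Label Σ₀)
  capRoot (just a) = capLabel (just a)
  capRoot nothing  = just (inj₂ 0)

  capᵀ : PreTerm U → PreTerm Σ₀
  capᵀ X []      = capRoot (X [])
  capᵀ X (i ∷ q) = cap X (i ∷ q)

  beneath-¬alien : ∀ m r → ¬ Alien m → beneath m r ≡ r
  beneath-¬alien (just (inj₁ G)) r ¬alien with layer G in e
  ... | just _  = refl
  ... | nothing = contradiction (G , refl , e) ¬alien
  beneath-¬alien (just (inj₂ x)) r _ = refl
  beneath-¬alien nothing         r _ = refl

  beneath-alien : ∀ m r → Alien m → beneath m r ≡ nothing
  beneath-alien .(just (inj₁ G)) r (G , refl , e) rewrite e = refl

  capLabel-alien : ∀ m → Alien m → capLabel m ≡ just (inj₂ 0)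
  capLabel-alien .(just (inj₁ G)) (G , refl , e) rewrite e = refl

  capLabel-embed : ∀ m → capLabel (embed m) ≡ m
  capLabel-embed (just (inj₁ F)) rewrite layer-ι F = refl
  capLabel-embed (just (inj₂ x)) = refl
  capLabel-embed nothing         = refl

  capLabel-defined : ∀ a → Defined (capLabel (just a))
  capLabel-defined (inj₁ G) with layer G
  ... | just F  = _ , refl
  ... | nothing = _ , refl
  capLabel-defined (inj₂ x) = _ , refl

  capLabel-defined⁻ : ∀ m → Defined (capLabel m) → Defined m
  capLabel-defined⁻ (just a) _       = a , refl
  capLabel-defined⁻ nothing  (_ , ())

  capRoot-defined : ∀ m → Defined (capRoot m)
  capRoot-defined (just a) = capLabel-defined a
  capRoot-defined nothing  = _ , refl

  cap-cong : ∀ {X Y} → X ≗ Y → cap X ≗ cap Y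
  cap-cong X≗Y []      = cong capLabel (X≗Y [])
  cap-cong X≗Y (i ∷ q) = cong₂ beneath (X≗Y []) (cap-cong (X≗Y ∘ (i ∷_)) q)

  capᵀ-cong : ∀ {X Y} → X ≗ Y → capᵀ X ≗ capᵀ Y
  capᵀ-cong X≗Y []      = cong capRoot (X≗Y [])
  capᵀ-cong X≗Y (i ∷ q) = cap-cong X≗Y (i ∷ q)

  capᵀ≗cap : ∀ X → Defined (X []) → capᵀ X ≗ cap X
  capᵀ≗cap X (a , e) [] rewrite e = refl
  capᵀ≗cap X _ (i ∷ q) = refl

  capᵀ-cong-cap : ∀ X Y → cap X ≗ cap Y → capᵀ X ≗ capᵀ Y
  capᵀ-cong-cap X Y capX≗capY (i ∷ q) = capX≗capY (i ∷ q)
  capᵀ-cong-cap X Y capX≗capY [] with X [] | Y [] | capX≗capY []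
  ... | just a  | just b  | e = e
  ... | nothing | nothing | _ = refl
  ... | just a  | nothing | e = case trans (sym (proj₂ (capLabel-defined a))) e of λ ()
  ... | nothing | just b  | e = case trans e (proj₂ (capLabel-defined b)) of λ ()

  cap-agree : ∀ n {X Y} → AgreeUpTo n X Y → AgreeUpTo n (cap X) (cap Y)
  cap-agree n       X≈Y []      _           = cong capLabel (X≈Y [] z≤n)
  cap-agree (suc n) X≈Y (i ∷ q) (s≤s |q|≤n) =
    cong₂ beneath (X≈Y [] z≤n) (cap-agree n (λ q′ |q′|≤n → X≈Y (i ∷ q′) (s≤s |q′|≤n)) q |q|≤n)

  capᵀ-agree : ∀ n {X Y} → AgreeUpTo n X Y → AgreeUpTo n (capᵀ X) (capᵀ Y)
  capᵀ-agree n X≈Y []      _ = cong capRoot (X≈Y [] z≤n)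
  capᵀ-agree n X≈Y (i ∷ q)   = cap-agree n X≈Y (i ∷ q)

  cap-childCondition : ∀ m d i → ChildCondition U m d i → ChildCondition Σ₀ (capLabel m) (beneath m (capLabel d)) i
  cap-childCondition (just (inj₁ G)) d i (to , from) with layer G in e
  ... | nothing = (λ { (_ , ()) }) , λ { (_ , () , _) }
  ... | just F with layer-just e
  ...   | refl = (λ d-def → F , refl , i<arF (to (capLabel-defined⁻ d d-def)))
               , λ { (_ , refl , i<ar) → cap-defined (from (ι F , refl , transport (i <ℕ_) (sym (ar-ι F)) i<ar)) }
    where
    i<arF : HasChild U (just (inj₁ (ι F))) i → i <ℕ ar Σ₀ F
    i<arF (_ , refl , i<ar) = transport (i <ℕ_) (ar-ι F) i<ar
    cap-defined : Defined d → Defined (capLabel d)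
    cap-defined (a , refl) = capLabel-defined a
  cap-childCondition (just (inj₂ x)) d i (to , _) =
    (λ d-def → case to (capLabel-defined⁻ d d-def) of λ { (_ , () , _) }) , λ { (_ , () , _) }
  cap-childCondition nothing d i (to , _) =
    (λ d-def → case to (capLabel-defined⁻ d d-def) of λ { (_ , () , _) }) , λ { (_ , () , _) }

  cap-children : ∀ X → Children U X → Children Σ₀ (cap X)
  cap-children X ch []      i = cap-childCondition (X []) (X [ i ]) i (ch [] i)
  cap-children X ch (j ∷ q) i with alien? (X [])
  ... | yes alien rewrite beneath-alien (X []) (cap (X ↓ [ j ]) (q ++ [ i ])) alien
                        | beneath-alien (X []) (cap (X ↓ [ j ]) q) alien =
    (λ { (_ , ()) }) , λ { (_ , () , _) }
  ... | no ¬alien rewrite beneath-¬alien (X []) (cap (X ↓ [ j ]) (q ++ [ i ])) ¬alien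
                        | beneath-¬alien (X []) (cap (X ↓ [ j ]) q) ¬alien =
    cap-children (X ↓ [ j ]) (ch ∘ (j ∷_)) q i

  capᵀ-children : ∀ X → Children U X → Children Σ₀ (capᵀ X)
  capᵀ-children X ch with X [] in e
  ... | just a  = children-cong (λ q → sym (capᵀ≗cap X (a , e) q)) (cap-children X ch)
  ... | nothing = children-at
    where
    children-at : Children Σ₀ (capᵀ X)
    children-at []      i rewrite e | root-undefined X ch e i = (λ { (_ , ()) }) , λ { (_ , () , _) }
    children-at (j ∷ q) i = cap-children X ch (j ∷ q) i

  capTerm : Term U → Pos → Term Σ₀
  capTerm t p = mkTerm (capᵀ (lab t ↓ p))
    (record { root = capRoot-defined (lab t (p ++ [])) ; children = capᵀ-children (lab t ↓ p) (children-↓ t p) })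

  capθ : (Var → Term U) → Var → Term Σ₀
  capθ θ x = capTerm (θ x) []

  ¬isVar-embed : ∀ {L₀ : PreTerm U} {L : PreTerm Σ₀} → L₀ ≗ embed ∘ L →
    ¬ IsVarLabel Σ₀ (L []) → ¬ IsVarLabel U (L₀ [])
  ¬isVar-embed {L = L} L₀≗ ¬var = embed-¬isVar {L []} ¬var ∘ transport (IsVarLabel U) (L₀≗ [])

  subst-embed-root : ∀ (θ : Var → Term U) {L₀ : PreTerm U} {L : PreTerm Σ₀} → L₀ ≗ embed ∘ L →
    ¬ IsVarLabel Σ₀ (L []) → ∀ {X : PreTerm U} → X ≗ subst L₀ θ → X [] ≡ embed (L [])
  subst-embed-root θ {L₀} L₀≗ ¬var X≗ = trans (X≗ []) (trans (subst-root L₀ θ (¬isVar-embed L₀≗ ¬var)) (L₀≗ []))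

  cap-subst : ∀ (θ : Var → Term U) (L₀ : PreTerm U) (L : PreTerm Σ₀) → L₀ ≗ embed ∘ L →
    ∀ {X : PreTerm U} → X ≗ subst L₀ θ → cap X ≗ subst L (capθ θ)
  cap-subst θ L₀ L L₀≗ {X} X≗ q with isVar? {Σ₀} (L [])
  ... | yes (x , e) = begin
    cap X q                ≡⟨ cap-cong (λ q′ → trans (X≗ q′) (subst-var L₀ θ (trans (L₀≗ []) (cong embed e)) q′)) q ⟩
    cap (lab (θ x)) q      ≡⟨ sym (capᵀ≗cap (lab (θ x)) (IsTerm.root (isTerm (θ x))) q) ⟩
    lab (capθ θ x) q       ≡⟨ sym (subst-var L (capθ θ) e q) ⟩
    subst L (capθ θ) q     ∎
  cap-subst θ L₀ L L₀≗ {X} X≗ [] | no ¬var = begin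
    capLabel (X [])          ≡⟨ cong capLabel (subst-embed-root θ L₀≗ ¬var X≗) ⟩
    capLabel (embed (L []))  ≡⟨ capLabel-embed (L []) ⟩
    L []                     ≡⟨ sym (subst-root L (capθ θ) ¬var) ⟩
    subst L (capθ θ) []      ∎
  cap-subst θ L₀ L L₀≗ {X} X≗ (i ∷ q) | no ¬var = begin
    beneath (X []) (cap (X ↓ [ i ]) q)  ≡⟨ beneath-¬alien (X []) _ (embed-¬alien (L []) ∘ transport Alien X-root) ⟩
    cap (X ↓ [ i ]) q                    ≡⟨ cap-subst θ (L₀ ↓ [ i ]) (L ↓ [ i ]) (L₀≗ ∘ (i ∷_)) X↓≗ q ⟩
    subst (L ↓ [ i ]) (capθ θ) q         ≡⟨ sym (subst-child L (capθ θ) ¬var i q) ⟩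
    subst L (capθ θ) (i ∷ q)             ∎
    where
    X-root = subst-embed-root θ L₀≗ ¬var X≗
    X↓≗ : X ↓ [ i ] ≗ subst (L₀ ↓ [ i ]) θ
    X↓≗ q′ = trans (X≗ (i ∷ q′)) (subst-child L₀ θ (¬isVar-embed L₀≗ ¬var) i q′)

  ImageRule : (Term Σ₀ → Term Σ₀ → Set) → Term U → Term U → Set
  ImageRule Rules l r = ∃ λ l′ → ∃ λ r′ → Rules l′ r′ × lab l ≗ embed ∘ lab l′ × lab r ≗ embed ∘ lab r′

  AlienRule : Term U → Term U → Set
  AlienRule l r = Alien (lab l []) × Alien (lab r [])

  InCap : PreTerm U → Pos → Set
  InCap X []      = Native (X [])
  InCap X (j ∷ k) = Native (X []) × InCap (X ↓ [ j ]) k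

  inCap-root : ∀ X k → InCap X k → Native (X [])
  inCap-root X []      native      = native
  inCap-root X (j ∷ k) (native , _) = native

  inCap-end : ∀ X k → InCap X k → Native (X k)
  inCap-end X []      native       = native
  inCap-end X (j ∷ k) (_ , inCap) = inCap-end (X ↓ [ j ]) k inCap

  cap-↓ : ∀ X k → InCap X k → ∀ q → cap X (k ++ q) ≡ cap (X ↓ k) q
  cap-↓ X []      _                q = refl
  cap-↓ X (j ∷ k) (native , inCap) q =
    trans (beneath-¬alien (X []) _ (native⇒¬alien native)) (cap-↓ (X ↓ [ j ]) k inCap q)

  cap-replace : ∀ X k S S′ → InCap X k → cap S ≗ S′ → cap (replace U X k S) ≗ replace Σ₀ (cap X) k S′
  cap-replace X []      S S′ _                capS≗S′ q       = capS≗S′ q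
  cap-replace X (j ∷ k) S S′ _                capS≗S′ []      = refl
  cap-replace X (j ∷ k) S S′ (native , inCap) capS≗S′ (i ∷ q) = by-cases (j ℕ.≟ i)
    where
    ¬alien = native⇒¬alien native
    by-cases : Dec (j ≡ i) → cap (replace U X (j ∷ k) S) (i ∷ q) ≡ replace Σ₀ (cap X) (j ∷ k) S′ (i ∷ q)
    by-cases (yes refl) = begin
      beneath (X []) (cap (replace U X (j ∷ k) S ↓ [ j ]) q)  ≡⟨ beneath-¬alien (X []) _ ¬alien ⟩
      cap (replace U X (j ∷ k) S ↓ [ j ]) q     ≡⟨ cap-cong (replace-++ U X S [ j ] k) q ⟩
      cap (replace U (X ↓ [ j ]) k S) q          ≡⟨ cap-replace (X ↓ [ j ]) k S S′ inCap capS≗S′ q ⟩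
      replace Σ₀ (cap (X ↓ [ j ])) k S′ q        ≡⟨ replace-congˡ Σ₀ S′ k (λ _ → sym (beneath-¬alien (X []) _ ¬alien)) q ⟩
      replace Σ₀ (cap X ↓ [ j ]) k S′ q          ≡⟨ sym (replace-++ Σ₀ (cap X) S′ [ j ] k q) ⟩
      replace Σ₀ (cap X) (j ∷ k) S′ (j ∷ q)      ∎
    by-cases (no j≢i) = trans (cong (beneath (X [])) (cap-cong (λ q′ → replace-∷-≢ U X S j k i q′ j≢i) q))
                              (sym (replace-∷-≢ Σ₀ (cap X) S′ j k i q j≢i))

  CapHides : PreTerm U → Pos → PreTerm U → Set
  CapHides X []      S = Alien (X []) × Alien (S [])
  CapHides X (j ∷ k) S = Alien (X []) ⊎ CapHides (X ↓ [ j ]) k S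

  cap-alien : ∀ X Y → Alien (X []) → Alien (Y []) → cap X ≗ cap Y
  cap-alien X Y alienX alienY []      = trans (capLabel-alien _ alienX) (sym (capLabel-alien _ alienY))
  cap-alien X Y alienX alienY (i ∷ q) = trans (beneath-alien _ _ alienX) (sym (beneath-alien _ _ alienY))

  cap-replace-hidden : ∀ X k S → CapHides X k S → cap (replace U X k S) ≗ cap X
  cap-replace-hidden X []      S (alienX , alienS)   q       = cap-alien S X alienS alienX q
  cap-replace-hidden X (j ∷ k) S (inj₁ alienX)       q       = cap-alien _ X alienX alienX q
  cap-replace-hidden X (j ∷ k) S (inj₂ _)            []      = refl
  cap-replace-hidden X (j ∷ k) S (inj₂ hides)        (i ∷ q) = cong (beneath (X [])) (by-cases (j ℕ.≟ i))
    where
    by-cases : Dec (j ≡ i) → cap (replace U X (j ∷ k) S ↓ [ i ]) q ≡ cap (X ↓ [ i ]) q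
    by-cases (yes refl) = trans (cap-cong (replace-++ U X S [ j ] k) q) (cap-replace-hidden (X ↓ [ j ]) k S hides q)
    by-cases (no j≢i)   = cap-cong (λ q′ → replace-∷-≢ U X S j k i q′ j≢i) q

  capHides : ∀ X k S → Children U X → IsSymLabel U (X k) → ¬ InCap X k →
    (Alien (X k) → Alien (S [])) → CapHides X k S
  capHides X [] S _ (G , e) ¬inCap alien⇒ with layer G in e′
  ... | just F  = contradiction (G , F , e , e′) ¬inCap
  ... | nothing = (G , e , e′) , alien⇒ (G , e , e′)
  capHides X (j ∷ k) S ch (G , e) ¬inCap alien⇒ with root-hasChild X ch j k (inj₁ G , e)
  ... | G₀ , e₀ , _ with layer G₀ in e′
  ...   | nothing = inj₁ (G₀ , e₀ , e′)
  ...   | just F  =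
    inj₂ (capHides (X ↓ [ j ]) k S (ch ∘ (j ∷_)) (G , e) (¬inCap ∘ ((G₀ , F , e₀ , e′) ,_)) alien⇒)

-- Projecting a reduction sequence onto a layer

module Projection {V T : iTRS} (E : Embedding (sig T) (sig V))
  (T-valid : IsITRS T) (T-nonCollapsing : NonCollapsing T) where

  open Layer E

  embed-root-native : ∀ {L : PreTerm (sig V)} (t′ : Term (sig T)) → L ≗ embed ∘ lab t′ →
    ¬ IsVarLabel (sig T) (lab t′ []) → Native (L [])
  embed-root-native t′ L≗ ¬var = transport Native (sym (L≗ [])) (embed-native (root-isSym t′ ¬var))

  module _ (classify : ∀ l r → Rule V l r → ImageRule (Rule T) l r ⊎ AlienRule l r) where

    lhs-isSym : ∀ {l r} → Rule V l r → IsSymLabel (sig V) (lab l [])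
    lhs-isSym {l} {r} rule with classify l r rule
    ... | inj₁ (l′ , r′ , rule′ , l≗ , _) = native⇒isSym (embed-root-native l′ l≗ (proj₁ (T-valid l′ r′ rule′)))
    ... | inj₂ (l-alien , _)              = alien⇒isSym l-alien

    module _ (p : Pos) where

      redex-↓ : ∀ (t : Term (sig V)) k (L : PreTerm (sig V)) (θ : Var → Term (sig V)) →
        (∀ q → lab t ((p ++ k) ++ q) ≡ subst L θ q) → (lab t ↓ p) ↓ k ≗ subst L θ
      redex-↓ t k L θ redex q = trans (cong (lab t) (sym (++-assoc p k q))) (redex q)

      redex-root : ∀ (t : Term (sig V)) k {l r} → Rule V l r → ∀ (θ : Var → Term (sig V)) →
        (∀ q → lab t ((p ++ k) ++ q) ≡ subst (lab l) θ q) → (lab t ↓ p) k ≡ lab l []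
      redex-root t k {l} rule θ redex = trans (↓-root (lab t ↓ p) k)
        (trans (redex-↓ t k (lab l) θ redex []) (subst-root (lab l) θ (isSym⇒¬isVar {sig V} (lhs-isSym rule))))

      contractum-↓ : ∀ (t u : Term (sig V)) k S → (∀ q → lab u q ≡ replace (sig V) (lab t) (p ++ k) S q) →
        lab u ↓ p ≗ replace (sig V) (lab t ↓ p) k S
      contractum-↓ t u k S contract q = trans (contract (p ++ q)) (replace-++ (sig V) (lab t) S p k q)

      step-disjoint : ∀ {P t u} → Step V P t u → strip p P ≡ nothing → ¬ ProperPrefix P p → lab u ↓ p ≗ lab t ↓ p
      step-disjoint {P} {t} (_ , _ , _ , _ , _ , contract) p⋢P P⋤p q =
        trans (contract (p ++ q)) (replace-outside (sig V) (lab t) _ P (p ++ q) (strip-++-incomparable P p p⋢P P⋤p q))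

      step-hidden : ∀ k {t u} → Step V (p ++ k) t u → ¬ InCap (lab t ↓ p) k → cap (lab u ↓ p) ≗ cap (lab t ↓ p)
      step-hidden k {t} {u} (l , r , rule , θ , redex , contract) ¬inCap q =
        trans (cap-cong (contractum-↓ t u k S contract) q)
              (cap-replace-hidden X k S (capHides X k S (children-↓ t p) X-k-isSym ¬inCap alien⇒) q)
        where
        X = lab t ↓ p
        S = subst (lab r) θ
        X-k = redex-root t k rule θ redex
        X-k-isSym : IsSymLabel (sig V) (X k)
        X-k-isSym = transport (IsSymLabel (sig V)) (sym X-k) (lhs-isSym rule)
        alien⇒ : Alien (X k) → Alien (S [])
        alien⇒ X-k-alien with classify l r rule
        ... | inj₁ (l′ , r′ , rule′ , l≗ , _) = contradiction (transport Alien X-k X-k-alien)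
                (native⇒¬alien (embed-root-native l′ l≗ (proj₁ (T-valid l′ r′ rule′))))
        ... | inj₂ (_ , r-alien) = transport Alien
                (sym (subst-root (lab r) θ (isSym⇒¬isVar {sig V} (alien⇒isSym r-alien)))) r-alien

      step-inCap : ∀ k {t u} → Step V (p ++ k) t u → InCap (lab t ↓ p) k → Step T k (capTerm t p) (capTerm u p)
      step-inCap k {t} {u} (l , r , rule , θ , redex , contract) inCap with classify l r rule
      ... | inj₂ (l-alien , _) = contradiction (transport Alien (sym (redex-root t k rule θ redex)) l-alien)
                                               (native⇒¬alien (inCap-end (lab t ↓ p) k inCap))
      ... | inj₁ (l′ , r′ , rule′ , l≗ , r≗) = l′ , r′ , rule′ , capθ θ , redex′ , contract′
        where
        X = lab t ↓ p
        S = subst (lab r) θ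
        S′ = subst (lab r′) (capθ θ)
        X-defined : Defined (X [])
        X-defined = isSym⇒defined {sig V} (native⇒isSym (inCap-root X k inCap))
        S-defined : Defined (S [])
        S-defined = transport Defined (sym (subst-root (lab r) θ (isSym⇒¬isVar {sig V} r-isSym))) (isSym⇒defined {sig V} r-isSym)
          where r-isSym = native⇒isSym (embed-root-native r′ r≗ (T-nonCollapsing l′ r′ rule′))
        redex′ : ∀ q → capᵀ X (k ++ q) ≡ subst (lab l′) (capθ θ) q
        redex′ q = begin
          capᵀ X (k ++ q)             ≡⟨ capᵀ≗cap X X-defined (k ++ q) ⟩
          cap X (k ++ q)              ≡⟨ cap-↓ X k inCap q ⟩
          cap (X ↓ k) q               ≡⟨ cap-subst θ (lab l) (lab l′) l≗ (redex-↓ t k (lab l) θ redex) q ⟩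
          subst (lab l′) (capθ θ) q   ∎
        contract′ : ∀ q → capᵀ (lab u ↓ p) q ≡ replace (sig T) (capᵀ X) k S′ q
        contract′ q = begin
          capᵀ (lab u ↓ p) q                  ≡⟨ capᵀ-cong (contractum-↓ t u k S contract) q ⟩
          capᵀ (replace (sig V) X k S) q      ≡⟨ capᵀ≗cap _ (replace-root-defined (sig V) X S k X-defined S-defined) q ⟩
          cap (replace (sig V) X k S) q       ≡⟨ cap-replace X k S S′ inCap (cap-subst θ (lab r) (lab r′) r≗ (λ _ → refl)) q ⟩
          replace (sig T) (cap X) k S′ q      ≡⟨ replace-congˡ (sig T) S′ k (sym ∘ capᵀ≗cap X X-defined) q ⟩
          replace (sig T) (capᵀ X) k S′ q     ∎

      module Along (em : ExcludedMiddle 0ℓ) (α : Ordinal) (s : OpenRedSeq V α) (β₀ : Carrier α)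
        (no-prefix-steps : ∀ γ → _≼_ α β₀ γ → ¬ ProperPrefix (pos s γ) p) where

        open ClassicalOrdinal em α
        open Ordinal α using () renaming (_≼_ to _≤_)

        capped : Carrier α → Term (sig T)
        capped γ = capTerm (f s γ) p

        InCapStep : Carrier α → Set
        InCapStep γ = ∃ λ k → pos s γ ≡ p ++ k × InCap (lab (f s γ) ↓ p) k

        capped-continuous : Continuous α capped
        capped-continuous l l-limit n with cont s l l-limit (length p ℕ.+ n)
        ... | β , β<l , close = β , β<l , λ γ β<γ γ<l →
          capᵀ-agree n (λ q |q|≤n → close γ β<γ γ<l (p ++ q) (|p++q|≤ q |q|≤n))
          where
          |p++q|≤ : ∀ q → length q ≤ℕ n → length (p ++ q) ≤ℕ length p ℕ.+ n
          |p++q|≤ q |q|≤n rewrite length-++ p {q} = +-monoʳ-≤ (length p) |q|≤n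

        step-at : ∀ {γ γ⁺ k} → IsSucc α γ γ⁺ → pos s γ ≡ p ++ k → Step V (p ++ k) (f s γ) (f s γ⁺)
        step-at {γ} {γ⁺} γ-succ pos≡ = transport (λ P → Step V P (f s γ) (f s γ⁺)) pos≡ (step s γ γ⁺ γ-succ)

        step-outside-cap : ∀ ε ε⁺ → β₀ ≤ ε → ¬ InCapStep ε → IsSucc α ε ε⁺ → lab (capped ε) ≗ lab (capped ε⁺)
        step-outside-cap ε ε⁺ β₀≤ε ¬inCap ε-succ with strip p (pos s ε) in e
        ... | nothing = capᵀ-cong {lab (f s ε) ↓ p} {lab (f s ε⁺) ↓ p}
            (sym ∘ step-disjoint {pos s ε} {f s ε} {f s ε⁺} (step s ε ε⁺ ε-succ) e (no-prefix-steps ε β₀≤ε))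
        ... | just k  = capᵀ-cong-cap (lab (f s ε) ↓ p) (lab (f s ε⁺) ↓ p)
            (sym ∘ step-hidden k {f s ε} {f s ε⁺} (step-at ε-succ pos≡) (λ inCap → ¬inCap (k , pos≡ , inCap)))
          where pos≡ = strip-sound p (pos s ε) e

        Projected : Carrier α → Set
        Projected γ = β₀ ≤ γ × InCapStep γ

        open Restriction Projected

        constantOnGaps : ConstantOnGaps capped
        constantOnGaps z a b (β₀≤z , _) z≤a a≤b gap = constant-on-interval capped capped-continuous a≤b
          λ ε ε⁺ a≤ε ε<b → let β₀≤ε = ≤-trans β₀≤z (≤-trans z≤a a≤ε) in
            step-outside-cap ε ε⁺ β₀≤ε (λ inCap → gap ε a≤ε ε<b (β₀≤ε , inCap))

        projected-pos : C′ → Pos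
        projected-pos x = proj₁ (proj₂ (member x))

        projected-step : ∀ x y → IsSucc restrict x y → Step T (projected-pos x) (capped (proj₁ x)) (capped (proj₁ y))
        projected-step x y x-succ-y with member x | successor (proj₁ x-succ-y)
        ... | _ , k , pos≡ , inCap | γ⁺ , γ⁺-succ =
          step-resp-target {T} {k} {capped (proj₁ x)} {capped γ⁺} {capped (proj₁ y)}
            (step-inCap k {f s (proj₁ x)} {f s γ⁺} (step-at γ⁺-succ pos≡) inCap) γ⁺≗y
          where
          γ⁺≗y : lab (capped γ⁺) ≗ lab (capped (proj₁ y))
          γ⁺≗y = constantOnGaps (proj₁ x) γ⁺ (proj₁ y) (member x) (inj₁ (proj₁ γ⁺-succ))
            (succ-least γ⁺-succ (proj₁ x-succ-y))
            λ ε γ⁺≤ε ε<y → restrict-gap {x} {y} x-succ-y ε (<-≤-trans (proj₁ γ⁺-succ) γ⁺≤ε) ε<y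

        projected : OpenRedSeq T restrict
        projected = record
          { f    = capped ∘ proj₁
          ; pos  = projected-pos
          ; cont = restrict-continuous capped capped-continuous constantOnGaps
          ; step = projected-step }

        projected-pos-unique : ∀ x k → pos s (proj₁ x) ≡ p ++ k → projected-pos x ≡ k
        projected-pos-unique x k pos≡ = ++-cancelˡ p _ k (trans (sym (proj₁ (proj₂ (proj₂ (member x))))) pos≡)

        NativeRedexesCofinal : Set
        NativeRedexesCofinal = ∀ β → ∃ λ γ → β ≤ γ × pos s γ ≡ p × Native (lab (f s γ) (p ++ []))

        projected-root-steps : NativeRedexesCofinal → ∀ β → ∃ λ γ → β ≤ γ × Projected γ × pos s γ ≡ p
        projected-root-steps cofinal β with join β β₀
        ... | m , β≤m , β₀≤m , _ with cofinal m
        ...   | γ , m≤γ , pos≡p , native =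
          γ , ≤-trans β≤m m≤γ , (≤-trans β₀≤m m≤γ , [] , trans pos≡p (sym (++-identityʳ p)) , native) , pos≡p

        -- The projection is an open reduction sequence of T with cofinally many root steps.
        nativeRedexes-not-cofinal : StronglyConverging T → IsLimitOrdinal α → ¬ NativeRedexesCofinal
        nativeRedexes-not-cofinal T-strong α-limit cofinal
          with T-strong restrict (restrict-limit α-limit projected-cofinal) projected []
          where
          projected-cofinal : ∀ β → ∃ λ γ → β ≤ γ × Projected γ
          projected-cofinal β = let (γ , β≤γ , Pγ , _) = projected-root-steps cofinal β in γ , β≤γ , Pγ
        ... | β′ , no-root-steps with projected-root-steps cofinal (proj₁ β′)
        ...   | γ , β′≤γ , Pγ , pos≡p = no-root-steps ⟨ Pγ ⟩ (≤⇒≤′ β′≤γ)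
          (projected-pos-unique ⟨ Pγ ⟩ [] (trans pos≡p (sym (++-identityʳ p))))


-- Disjoint unions

module Union (R S : iTRS) where

  fromLeft : Sym (sig R ⊕ sig S) → Maybe (Sym (sig R))
  fromLeft (inj₁ F) = just F
  fromLeft (inj₂ _) = nothing

  fromRight : Sym (sig R ⊕ sig S) → Maybe (Sym (sig S))
  fromRight (inj₁ _) = nothing
  fromRight (inj₂ G) = just G

  fromLeft-just : ∀ {G F} → fromLeft G ≡ just F → G ≡ inj₁ F
  fromLeft-just {inj₁ _} refl = refl
  fromLeft-just {inj₂ _} ()

  fromRight-just : ∀ {G F} → fromRight G ≡ just F → G ≡ inj₂ F
  fromRight-just {inj₁ _} ()
  fromRight-just {inj₂ _} refl = refl

  left-embedding : Embedding (sig R) (sig R ⊕ sig S)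
  left-embedding = record
    { ι = inj₁ ; layer = fromLeft ; layer-ι = λ _ → refl ; layer-just = fromLeft-just ; ar-ι = λ _ → refl }

  right-embedding : Embedding (sig S) (sig R ⊕ sig S)
  right-embedding = record
    { ι = inj₂ ; layer = fromRight ; layer-ι = λ _ → refl ; layer-just = fromRight-just ; ar-ι = λ _ → refl }

  module Left  = Layer left-embedding
  module Right = Layer right-embedding

  mapLabel₁≡embed : ∀ m → mapLabel₁ {sig R} {sig S} m ≡ Left.embed m
  mapLabel₁≡embed (just (inj₁ F)) = refl
  mapLabel₁≡embed (just (inj₂ x)) = refl
  mapLabel₁≡embed nothing         = refl

  mapLabel₂≡embed : ∀ m → mapLabel₂ {sig R} {sig S} m ≡ Right.embed m
  mapLabel₂≡embed (just (inj₁ G)) = refl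
  mapLabel₂≡embed (just (inj₂ x)) = refl
  mapLabel₂≡embed nothing         = refl

  symbol-native : ∀ {m} → IsSymLabel (sig R ⊕ sig S) m → Left.Native m ⊎ Right.Native m
  symbol-native (inj₁ F , e) = inj₁ (inj₁ F , F , e , refl)
  symbol-native (inj₂ G , e) = inj₂ (inj₂ G , G , e , refl)

  right-root-alien : ∀ {L : PreTerm (sig R ⊕ sig S)} (t : Term (sig S)) → L ≗ mapLabel₂ {sig R} {sig S} ∘ lab t →
    ¬ IsVarLabel (sig S) (lab t []) → Left.Alien (L [])
  right-root-alien t L≗ ¬var with root-isSym t ¬var
  ... | G , e = inj₂ G , trans (L≗ []) (cong (mapLabel₂ {sig R} {sig S}) e) , refl

  left-root-alien : ∀ {L : PreTerm (sig R ⊕ sig S)} (t : Term (sig R)) → L ≗ mapLabel₁ {sig R} {sig S} ∘ lab t →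
    ¬ IsVarLabel (sig R) (lab t []) → Right.Alien (L [])
  left-root-alien t L≗ ¬var with root-isSym t ¬var
  ... | F , e = inj₁ F , trans (L≗ []) (cong (mapLabel₁ {sig R} {sig S}) e) , refl

  classifyˡ : IsITRS S → NonCollapsing S →
    ∀ l r → Rule (R +ᵀ S) l r → Left.ImageRule (Rule R) l r ⊎ Left.AlienRule l r
  classifyˡ _ _ l r (inj₁ (l₁ , r₁ , rule , l≗ , r≗)) =
    inj₁ (l₁ , r₁ , rule , (λ q → trans (l≗ q) (mapLabel₁≡embed (lab l₁ q)))
                         , (λ q → trans (r≗ q) (mapLabel₁≡embed (lab r₁ q))))
  classifyˡ S-valid S-nonCollapsing l r (inj₂ (l₂ , r₂ , rule , l≗ , r≗)) =
    inj₂ (right-root-alien l₂ l≗ (proj₁ (S-valid l₂ r₂ rule)) , right-root-alien r₂ r≗ (S-nonCollapsing l₂ r₂ rule))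

  classifyʳ : IsITRS R → NonCollapsing R →
    ∀ l r → Rule (R +ᵀ S) l r → Right.ImageRule (Rule S) l r ⊎ Right.AlienRule l r
  classifyʳ _ _ l r (inj₂ (l₂ , r₂ , rule , l≗ , r≗)) =
    inj₁ (l₂ , r₂ , rule , (λ q → trans (l≗ q) (mapLabel₂≡embed (lab l₂ q)))
                         , (λ q → trans (r≗ q) (mapLabel₂≡embed (lab r₂ q))))
  classifyʳ R-valid R-nonCollapsing l r (inj₁ (l₁ , r₁ , rule , l≗ , r≗)) =
    inj₂ (left-root-alien l₁ l≗ (proj₁ (R-valid l₁ r₁ rule)) , left-root-alien r₁ r≗ (R-nonCollapsing l₁ r₁ rule))

  module Convergence (em : ExcludedMiddle 0ℓ)
    (R-valid : IsITRS R) (S-valid : IsITRS S)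
    (R-nonCollapsing : NonCollapsing R) (S-nonCollapsing : NonCollapsing S)
    (R-strong : StronglyConverging R) (S-strong : StronglyConverging S)
    (α : Ordinal) (α-limit : IsLimitOrdinal α) (s : OpenRedSeq (R +ᵀ S) α) where

    open ClassicalOrdinal em α
    open Ordinal α using () renaming (_≼_ to _≤_)

    module LeftProjection  = Projection {R +ᵀ S} {R} left-embedding R-valid R-nonCollapsing
    module RightProjection = Projection {R +ᵀ S} {S} right-embedding S-valid S-nonCollapsing

    redex-native : ∀ γ →
      Left.Native (lab (f s γ) (pos s γ ++ [])) ⊎ Right.Native (lab (f s γ) (pos s γ ++ []))
    redex-native γ with proj₂ α-limit γ
    ... | _ , γ<δ with successor γ<δ
    ...   | γ⁺ , γ⁺-succ = symbol-native (redex-isSym {R +ᵀ S}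
      (λ {l} {r} → LeftProjection.lhs-isSym (classifyˡ S-valid S-nonCollapsing) {l} {r})
      {pos s γ} {f s γ} {f s γ⁺} (step s γ γ⁺ γ⁺-succ))

    eventually-no-step-at : ∀ p β₀ → (∀ γ → β₀ ≤ γ → ¬ ProperPrefix (pos s γ) p) →
      ∃ λ β → ∀ γ → β ≤ γ → pos s γ ≢ p
    eventually-no-step-at p β₀ no-prefix-steps = decidable-stable em λ ¬eventually →
      case em {LeftAlong.NativeRedexesCofinal} of λ
        { (yes left-cofinal) → LeftAlong.nativeRedexes-not-cofinal R-strong α-limit left-cofinal
        ; (no ¬left-cofinal) → RightAlong.nativeRedexes-not-cofinal S-strong α-limit (right-cofinal ¬eventually ¬left-cofinal) }
      where
      module LeftAlong  = LeftProjection.Along (classifyˡ S-valid S-nonCollapsing) p em α s β₀ no-prefix-steps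
      module RightAlong = RightProjection.Along (classifyʳ R-valid R-nonCollapsing) p em α s β₀ no-prefix-steps

      right-cofinal : ¬ (∃ λ β → ∀ γ → β ≤ γ → pos s γ ≢ p) → ¬ LeftAlong.NativeRedexesCofinal →
        RightAlong.NativeRedexesCofinal
      right-cofinal ¬eventually ¬left-cofinal β = case join β β₁ of λ
        { (m , β≤m , β₁≤m , _) → case steps-cofinal m of λ
          { (γ , m≤γ , refl) → case redex-native γ of λ
            { (inj₁ left-native)  → contradiction (γ , ≤-trans β₁≤m m≤γ , refl , left-native) ¬left-after-β₁
            ; (inj₂ right-native) → γ , ≤-trans β≤m m≤γ , refl , right-native } } }
        where
        steps-cofinal : ∀ β → ∃ λ γ → β ≤ γ × pos s γ ≡ p
        steps-cofinal β = decidable-stable em λ ∄γ → ¬eventually (β , λ γ β≤γ pos≡p → ∄γ (γ , β≤γ , pos≡p))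
        left-bound : ∃ λ β₁ → ¬ ∃ λ γ → β₁ ≤ γ × pos s γ ≡ p × Left.Native (lab (f s γ) (p ++ []))
        left-bound = decidable-stable em λ ∄β₁ → ¬left-cofinal λ β → decidable-stable em λ ∄γ → ∄β₁ (β , ∄γ)
        β₁ = proj₁ left-bound
        ¬left-after-β₁ = proj₂ left-bound

    EventuallyAvoidsPrefixesOf : Pos → Set
    EventuallyAvoidsPrefixesOf p = ∃ λ β → ∀ γ → β ≤ γ → ∀ q → Prefix q p → pos s γ ≢ q

    eventually-avoids-prefixes : ∀ {p} → Reverse p → EventuallyAvoidsPrefixesOf p
    eventually-avoids-prefixes [] with eventually-no-step-at [] (proj₁ α-limit)
                                         (λ { γ _ (j , k , e) → case ++-conicalʳ (pos s γ) (j ∷ k) e of λ () })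
    ... | β , avoid = β , λ γ β≤γ q (k , q++k≡[]) pos≡q → avoid γ β≤γ (trans pos≡q (++-conicalˡ q k q++k≡[]))
    eventually-avoids-prefixes (p ∶ rp ∶ʳ i) with eventually-avoids-prefixes rp
    ... | β₁ , avoid₁ with eventually-no-step-at (p ∷ʳ i) β₁ (λ γ β₁≤γ P⊏ →
                             avoid₁ γ β₁≤γ (pos s γ) (properPrefix-∷ʳ (pos s γ) p i P⊏) refl)
    ...   | β₂ , avoid₂ with join β₁ β₂
    ...     | m , β₁≤m , β₂≤m , _ = m , λ γ m≤γ q (k , e) pos≡q → case prefix-∷ʳ q k p i e of λ
              { (inj₁ q≡p∷ʳi) → avoid₂ γ (≤-trans β₂≤m m≤γ) (trans pos≡q q≡p∷ʳi)
              ; (inj₂ q⊑p)    → avoid₁ γ (≤-trans β₁≤m m≤γ) q q⊑p pos≡q }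

    strongly-converging : ∀ p → ∃ λ β → ∀ γ → β ≤ γ → pos s γ ≢ p
    strongly-converging p with eventually-avoids-prefixes (reverseView p)
    ... | β , avoid = β , λ γ β≤γ → avoid γ β≤γ p (_ , ++-identityʳ p)

theorem10p1 : (lem : ∀ {ℓ : Level} → ExcludedMiddle ℓ) →
    (R S : iTRS) → IsITRS R → IsITRS S →
    NonCollapsing R → NonCollapsing S →
    StronglyConverging R → StronglyConverging S →
    StronglyConverging (R +ᵀ S)
theorem10p1 lem R S R-valid S-valid R-nonCollapsing S-nonCollapsing R-strong S-strong α α-limit s =
  Union.Convergence.strongly-converging R S lem
    R-valid S-valid R-nonCollapsing S-nonCollapsing R-strong S-strong α α-limit s
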